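{- Let $E$ be a finite set, $(\sigma_\circ,\sigma_\bullet)$ an arbitrary pair in $S_E$ with synthetic genus $g$, let $a,b\in E$ be distinct, let $t\in S_E$ be the transposition exchanging $a$ and $b$, and let $g^t$ be the synthetic genus of $(\sigma_\circ^t,\sigma_\bullet)$. Then $g^t<g$ if and only if all of the following hold: (1) $a$ and $b$ lie in the same $\sigma_\circ\sigma_\bullet$-orbit; (2) $\sigma_\circ(a)$ and $\sigma_\circ(b)$ lie in the same $\sigma_\circ\sigma_\bullet$-orbit; (3) either the $\sigma_\circ\sigma_\bullet$-arc from $a$ to $b$ contains neither $\sigma_\circ(a)$ nor $\sigma_\circ(b)$, or the $\sigma_\circ\sigma_\bullet$-arc from $b$ to $a$ contains neither of them. In this case $g^t=g-1$.
   Context: Permutations compose functionally, $\pi^s=s\pi s^{ -1}$, $z(\pi)$ is the number of $\pi$-orbits (fixed points included). Synthetic genus of $(\sigma_\circ,\sigma_\bullet)$ in $S_E$: $g=1-\chi/2$, $\chi=z(\sigma_\circ)+z(\sigma_\bullet)-|E|+z(\sigma_\circ\sigma_\bullet)$. Arcs: for $\pi\in S_E$ and $x,y$ in the same $\pi$-orbit, let $x_0,\dots,x_n$ be the shortest sequence with $x_0=x$, $x_n=y$, $x_{i+1}=\pi(x_i)$; if $x\ne y$ the $\pi$-arc from $x$ to $y$ is $x_1,\dots,x_n$, and if $x=y$ it is empty. -}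

module Defs where

open import Data.Nat using (ℕ; zero; suc; _≤_; _<_)
open import Data.Fin using (Fin) renaming (_≤_ to _≤ᶠ_)
open import Data.Fin.Permutation using (Permutation′; _⟨$⟩ʳ_; _∘ₚ_; flip)
open import Data.Fin.Properties using (_≤?_)
open import Data.List using (List; length)
open import Data.List.Base using (allFin; map)
open import Data.Bool.ListAction using (and)
open import Data.Bool using (Bool)
open import Relation.Nullary.Decidable using (does)
open import Data.Integer using (ℤ; +_; _+_; _-_)
open import Data.Rational using (ℚ; _/_) renaming (_-_ to _-ℚ_; 1ℚ to oneℚ)
open import Data.Product using (∃-syntax; _×_)
open import Relation.Binary.PropositionalEquality using (_≡_; _≢_)

Perm : ℕ → Set
Perm n = Permutation′ n

-- Functional composition: (σ · τ)(x) = σ(τ(x)).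
-- (stdlib's _∘ₚ_ is diagrammatic: (π₁ ∘ₚ π₂) x = π₂ (π₁ x).)
infixl 7 _·_
_·_ : ∀ {n} → Perm n → Perm n → Perm n
σ · τ = τ ∘ₚ σ

conj : ∀ {n} → Perm n → Perm n → Perm n
conj π s = s · π · flip s

iter : ∀ {n} → Perm n → ℕ → Fin n → Fin n
iter π zero    x = x
iter π (suc k) x = π ⟨$⟩ʳ iter π k x

SameOrbit : ∀ {n} → Perm n → Fin n → Fin n → Set
SameOrbit π x y = ∃[ k ] iter π k x ≡ y

-- x is the least element of its π-orbit (every orbit point is π^k x for some k < n).
isOrbitMin : ∀ {n} → Perm n → Fin n → Bool
isOrbitMin {n} π x = and (map (λ i → does (x ≤? iter π (Data.Fin.toℕ i) x)) (allFin n))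

-- z(π): the number of π-orbits (fixed points included), counted via one
-- representative (the minimum) per orbit.
z : ∀ {n} → Perm n → ℕ
z {n} π = length (Data.List.Base.filterᵇ (isOrbitMin π) (allFin n))

chi : ∀ {n} → Perm n → Perm n → ℤ
chi {n} σ₀ σ₁ = (+ z σ₀) + (+ z σ₁) - (+ n) + (+ z (σ₀ · σ₁))

genus : ∀ {n} → Perm n → Perm n → ℚ
genus σ₀ σ₁ = oneℚ -ℚ (chi σ₀ σ₁ / 2)

-- c belongs to the π-arc from x to y: c = x_i for some 1 ≤ i ≤ m, where
-- x_0 = x, x_{j+1} = π(x_j), and m is the least index with x_m = y
-- (empty when x = y).
InArc : ∀ {n} → Perm n → Fin n → Fin n → Fin n → Set
InArc π x y c = ∃[ i ] (1 ≤ i × iter π i x ≡ c × (∀ j → j < i → iter π j x ≢ y))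

-- Write ρ = σ∘σ•, t = (a b), a′ = σ∘ a and b′ = σ∘ b. Then σ∘ᵗσ• = t (a′ b′) ρ, and conjugating σ∘
-- does not change z(σ∘), so only z(σ∘ᵗσ•) against z(ρ) matters. Multiplying a permutation π on the left
-- by a transposition (p q) cuts the π-cycle through p and q in two when p and q share a cycle (z grows
-- by one), and otherwise merges the cycles of p and q (z drops by one). So the genus drops, and then by
-- exactly one, iff both multiplications cut: a′ and b′ share a ρ-cycle, and a and b share a cycle of
-- ρ₁ = (a′ b′) ρ. Cutting at a′, b′ leaves the cycles (a′, ρ a′, …) up to just before b′ and
-- (b′, ρ b′, …) up to just before a′, so a and b stay together iff one of the two ρ-arcs between them
-- avoids both a′ and b′.
module Submission where

module Orbits where

  open import Defs
  open import Level using (Level; 0ℓ)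
  open import Data.Bool using (Bool; T; true; false; if_then_else_)
  open import Data.Empty using (⊥-elim)
  open import Data.Fin using (Fin; zero; suc; toℕ; fromℕ<) renaming (_≤_ to _≤ᶠ_)
  open import Data.Fin.Permutation using (_⟨$⟩ʳ_; _⟨$⟩ˡ_; inverseˡ)
  import Data.Fin.Permutation as Perm
  open import Data.Fin.Permutation.Components using (transpose; transpose-inverse)
  open import Data.Fin.Properties using (_≟_; _≤?_; ≤-antisym; suc-injective; pigeonhole; any?; toℕ<n; toℕ-fromℕ<)
  open import Data.List using (length; filter; tabulate; allFin)
  open import Data.List.Relation.Unary.All.Properties using (all⁺; all⁻; tabulate⁺; tabulate⁻)
  open import Data.Nat using (ℕ; zero; suc; _+_; _*_; _∸_; _≤_; _<_; z≤n; s≤s)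
  import Data.Nat.Properties as ℕ
  open import Data.Nat.DivMod using (_%_; _/_; m≡m%n+[m/n]*n; m%n<n)
  open import Data.Product using (∃-syntax; _×_; _,_; proj₁; proj₂; swap)
  open import Data.Sum using (_⊎_; inj₁; inj₂; [_,_]; map)
  open import Function using (_∘_; case_of_)
  open import Function.Bundles using (_⇔_; mk⇔; Equivalence)
  open import Relation.Binary.PropositionalEquality
    using (_≡_; _≢_; refl; sym; trans; cong; cong₂; subst; module ≡-Reasoning)
  open import Relation.Nullary using (¬_; Dec; yes; no)
  open import Relation.Nullary.Decidable using (T?; map′; does; proof)
  open import Relation.Nullary.Reflects using (Reflects; ofʸ; ofⁿ)
  open import Relation.Unary using (Pred; Decidable; _∩_)
  open import Relation.Unary.Properties using (_∩?_; _∪?_; ∁?)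

  private variable
    n : ℕ
    ℓ ℓ′ : Level
    A : Set ℓ

  transpose-≡₁ : (p q : Fin n) → transpose p q p ≡ q
  transpose-≡₁ p q with p ≟ p
  ... | yes _  = refl
  ... | no p≢p = ⊥-elim (p≢p refl)

  transpose-≡₂ : (p q : Fin n) → transpose p q q ≡ p
  transpose-≡₂ p q with q ≟ p
  ... | yes q≡p = q≡p
  ... | no _ with q ≟ q
  ...   | yes _  = refl
  ...   | no q≢q = ⊥-elim (q≢q refl)

  transpose-≢ : {p q u : Fin n} → u ≢ p → u ≢ q → transpose p q u ≡ u
  transpose-≢ {p = p} {q} {u} u≢p u≢q with u ≟ p
  ... | yes u≡p = ⊥-elim (u≢p u≡p)
  ... | no _ with u ≟ q
  ...   | yes u≡q = ⊥-elim (u≢q u≡q)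
  ...   | no _    = refl

  transpose-sym : (p q u : Fin n) → transpose p q u ≡ transpose q p u
  transpose-sym p q u = by-cases (u ≟ p) (u ≟ q)
    where
    by-cases : Dec (u ≡ p) → Dec (u ≡ q) → transpose p q u ≡ transpose q p u
    by-cases (yes refl) (yes refl) = refl
    by-cases (yes refl) (no _)     = trans (transpose-≡₁ u q) (sym (transpose-≡₂ q u))
    by-cases (no _)     (yes refl) = trans (transpose-≡₂ p u) (sym (transpose-≡₁ u p))
    by-cases (no u≢p)   (no u≢q)   = trans (transpose-≢ u≢p u≢q) (sym (transpose-≢ u≢q u≢p))

  transpose-involutive : (p q u : Fin n) → transpose p q (transpose p q u) ≡ u
  transpose-involutive p q u = trans (cong (transpose p q) (transpose-sym p q u)) (transpose-inverse p q)

  ⟨$⟩ʳ-injective : (π : Perm n) {x y : Fin n} → π ⟨$⟩ʳ x ≡ π ⟨$⟩ʳ y → x ≡ y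
  ⟨$⟩ʳ-injective π e = trans (sym (inverseˡ π)) (trans (cong (π ⟨$⟩ˡ_) e) (inverseˡ π))

  ⟨$⟩ʳ-transpose : (σ : Perm n) (p q u : Fin n) →
                   σ ⟨$⟩ʳ transpose p q u ≡ transpose (σ ⟨$⟩ʳ p) (σ ⟨$⟩ʳ q) (σ ⟨$⟩ʳ u)
  ⟨$⟩ʳ-transpose σ p q u = by-cases (u ≟ p) (u ≟ q)
    where
    by-cases : Dec (u ≡ p) → Dec (u ≡ q) →
               σ ⟨$⟩ʳ transpose p q u ≡ transpose (σ ⟨$⟩ʳ p) (σ ⟨$⟩ʳ q) (σ ⟨$⟩ʳ u)
    by-cases (yes refl) _          = trans (cong (σ ⟨$⟩ʳ_) (transpose-≡₁ u q)) (sym (transpose-≡₁ (σ ⟨$⟩ʳ u) (σ ⟨$⟩ʳ q)))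
    by-cases (no _)     (yes refl) = trans (cong (σ ⟨$⟩ʳ_) (transpose-≡₂ p u)) (sym (transpose-≡₂ (σ ⟨$⟩ʳ p) (σ ⟨$⟩ʳ u)))
    by-cases (no u≢p)   (no u≢q)   = trans (cong (σ ⟨$⟩ʳ_) (transpose-≢ u≢p u≢q))
      (sym (transpose-≢ (u≢p ∘ ⟨$⟩ʳ-injective σ) (u≢q ∘ ⟨$⟩ʳ-injective σ)))

  iter-+ : (π : Perm n) (i j : ℕ) (x : Fin n) → iter π (i + j) x ≡ iter π i (iter π j x)
  iter-+ π zero    j x = refl
  iter-+ π (suc i) j x = cong (π ⟨$⟩ʳ_) (iter-+ π i j x)

  iter-injective : (π : Perm n) (k : ℕ) {x y : Fin n} → iter π k x ≡ iter π k y → x ≡ y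
  iter-injective π zero    e = e
  iter-injective π (suc k) e = iter-injective π k (⟨$⟩ʳ-injective π e)

  iter-*-fixed : (π : Perm n) (P : ℕ) {x : Fin n} → iter π P x ≡ x → ∀ k → iter π (k * P) x ≡ x
  iter-*-fixed π P     e zero    = refl
  iter-*-fixed π P {x} e (suc k) = begin
    iter π (P + k * P) x         ≡⟨ iter-+ π P (k * P) x ⟩
    iter π P (iter π (k * P) x)  ≡⟨ cong (iter π P) (iter-*-fixed π P e k) ⟩
    iter π P x                   ≡⟨ e ⟩
    x                            ∎
    where open ≡-Reasoning

  iter-period : (π : Perm n) (x : Fin n) → ∃[ P ] suc P ≤ n × iter π (suc P) x ≡ x
  iter-period {n} π x with pigeonhole (ℕ.n<1+n n) (λ (i : Fin (suc n)) → iter π (toℕ i) x)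
  ... | i , j , i<j , eᵢⱼ = period d d≤n returns (ℕ.m<n⇒0<n∸m i<j)
    where
    d : ℕ
    d = toℕ j ∸ toℕ i
    d≤n : d ≤ n
    d≤n = ℕ.≤-trans (ℕ.m∸n≤m (toℕ j) (toℕ i)) (ℕ.≤-pred (toℕ<n j))
    returns : iter π d x ≡ x
    returns = sym (iter-injective π (toℕ i) (begin
      iter π (toℕ i) x          ≡⟨ eᵢⱼ ⟩
      iter π (toℕ j) x          ≡⟨ cong (λ m → iter π m x) (sym (ℕ.m∸n+n≡m (ℕ.<⇒≤ i<j))) ⟩
      iter π (d + toℕ i) x      ≡⟨ cong (λ m → iter π m x) (ℕ.+-comm d (toℕ i)) ⟩
      iter π (toℕ i + d) x      ≡⟨ iter-+ π (toℕ i) d x ⟩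
      iter π (toℕ i) (iter π d x) ∎))
      where open ≡-Reasoning
    period : ∀ m → m ≤ n → iter π m x ≡ x → 0 < m → ∃[ P ] suc P ≤ n × iter π (suc P) x ≡ x
    period (suc m) m≤n e _ = m , m≤n , e

  iter-mod : (π : Perm n) (P : ℕ) {x : Fin n} → iter π (suc P) x ≡ x →
             ∀ k → iter π k x ≡ iter π (k % suc P) x
  iter-mod π P {x} e k = begin
    iter π k x                                        ≡⟨ cong (λ m → iter π m x) (m≡m%n+[m/n]*n k (suc P)) ⟩
    iter π (k % suc P + k / suc P * suc P) x           ≡⟨ iter-+ π (k % suc P) _ x ⟩
    iter π (k % suc P) (iter π (k / suc P * suc P) x) ≡⟨ cong (iter π (k % suc P)) (iter-*-fixed π (suc P) e (k / suc P)) ⟩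
    iter π (k % suc P) x                              ∎
    where open ≡-Reasoning

  sameOrbit-refl : (π : Perm n) {x : Fin n} → SameOrbit π x x
  sameOrbit-refl π = 0 , refl

  sameOrbit-step : (π : Perm n) {x : Fin n} → SameOrbit π x (π ⟨$⟩ʳ x)
  sameOrbit-step π = 1 , refl

  sameOrbit-trans : (π : Perm n) {x y w : Fin n} → SameOrbit π x y → SameOrbit π y w → SameOrbit π x w
  sameOrbit-trans π {x} (i , refl) (j , refl) = j + i , iter-+ π j i x

  sameOrbit-sym : (π : Perm n) {x y : Fin n} → SameOrbit π x y → SameOrbit π y x
  sameOrbit-sym π {x} (k , refl) with iter-period π x
  ... | P , _ , e = k * suc P ∸ k , (begin
    iter π (k * suc P ∸ k) (iter π k x) ≡⟨ sym (iter-+ π (k * suc P ∸ k) k x) ⟩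
    iter π (k * suc P ∸ k + k) x        ≡⟨ cong (λ m → iter π m x) (ℕ.m∸n+n≡m (ℕ.m≤m*n k (suc P))) ⟩
    iter π (k * suc P) x                ≡⟨ iter-*-fixed π (suc P) e k ⟩
    x                                   ∎)
    where open ≡-Reasoning

  sameOrbit-bounded : (π : Perm n) {x y : Fin n} → SameOrbit π x y → ∃[ i ] iter π (toℕ i) x ≡ y
  sameOrbit-bounded {n} π {x} (k , refl) with iter-period π x
  ... | P , P<n , e = fromℕ< k%P<n , trans (cong (λ m → iter π m x) (toℕ-fromℕ< k%P<n)) (sym (iter-mod π P e k))
    where
    k%P<n : k % suc P < n
    k%P<n = ℕ.≤-trans (m%n<n k (suc P)) P<n

  sameOrbit-⟨$⟩ʳ : (π : Perm n) {x y : Fin n} → SameOrbit π x y → SameOrbit π (π ⟨$⟩ʳ x) (π ⟨$⟩ʳ y)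
  sameOrbit-⟨$⟩ʳ π x~y =
    sameOrbit-trans π (sameOrbit-sym π (sameOrbit-step π)) (sameOrbit-trans π x~y (sameOrbit-step π))

  sameOrbit-⟨$⟩ʳ⁻ : (π : Perm n) {x y : Fin n} → SameOrbit π (π ⟨$⟩ʳ x) (π ⟨$⟩ʳ y) → SameOrbit π x y
  sameOrbit-⟨$⟩ʳ⁻ π πx~πy =
    sameOrbit-trans π (sameOrbit-step π) (sameOrbit-trans π πx~πy (sameOrbit-sym π (sameOrbit-step π)))

  sameOrbit? : (π : Perm n) (x : Fin n) → Decidable (SameOrbit π x)
  sameOrbit? π x y with any? (λ i → iter π (toℕ i) x ≟ y)
  ... | yes (i , e) = yes (toℕ i , e)
  ... | no ∄i       = no (∄i ∘ sameOrbit-bounded π)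

  least-witness : {P : Pred ℕ ℓ} → Decidable P → ∀ {k} → P k → ∃[ m ] P m × (∀ {j} → j < m → ¬ P j)
  least-witness {P = P} P? {k} pk = search k 0 (λ ()) pk
    where
    search : ∀ f s → (∀ {j} → j < s → ¬ P j) → P (s + f) → ∃[ m ] P m × (∀ {j} → j < m → ¬ P j)
    search f s below ps+f with P? s
    ... | yes ps = s , ps , below
    search zero    s below ps+f | no ¬ps = ⊥-elim (¬ps (subst P (ℕ.+-identityʳ s) ps+f))
    search (suc f) s below ps+f | no ¬ps = search f (suc s) below′ (subst P (ℕ.+-suc s f) ps+f)
      where
      below′ : ∀ {j} → j < suc s → ¬ P j
      below′ j<1+s with ℕ.m<1+n⇒m<n∨m≡n j<1+s
      ... | inj₁ j<s  = below j<s
      ... | inj₂ refl = ¬ps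

  least-element : {P : Pred (Fin n) ℓ} → Decidable P → ∀ {x} → P x → ∃[ m ] P m × (∀ {y} → P y → m ≤ᶠ y)
  least-element {suc n} P? px with P? zero
  ... | yes p₀ = zero , p₀ , λ _ → z≤n
  least-element {suc n} P? {zero}  px | no ¬p₀ = ⊥-elim (¬p₀ px)
  least-element {suc n} P? {suc x} px | no ¬p₀ with least-element (P? ∘ suc) px
  ... | m , pm , least = suc m , pm , λ { {zero} p₀ → ⊥-elim (¬p₀ p₀) ; {suc y} py → s≤s (least py) }

  count : {P : Pred (Fin n) ℓ} → Decidable P → ℕ
  count {zero}  P? = 0
  count {suc n} P? = if does (P? zero) then suc (count (P? ∘ suc)) else count (P? ∘ suc)

  count-cong : {P : Pred (Fin n) ℓ} {Q : Pred (Fin n) ℓ′} (P? : Decidable P) (Q? : Decidable Q) →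
               (∀ {i} → P i → Q i) → (∀ {i} → Q i → P i) → count P? ≡ count Q?
  count-cong {zero}  _  _  _   _   = refl
  count-cong {suc n} P? Q? P⇒Q Q⇒P with P? zero | Q? zero
  ... | yes _  | yes _  = cong suc (count-cong (P? ∘ suc) (Q? ∘ suc) P⇒Q Q⇒P)
  ... | yes p  | no ¬q  = ⊥-elim (¬q (P⇒Q p))
  ... | no ¬p  | yes q  = ⊥-elim (¬p (Q⇒P q))
  ... | no _   | no _   = count-cong (P? ∘ suc) (Q? ∘ suc) P⇒Q Q⇒P

  count-∪ : {P : Pred (Fin n) ℓ} {Q : Pred (Fin n) ℓ′} (P? : Decidable P) (Q? : Decidable Q) →
            (∀ {i} → P i → ¬ Q i) → count (P? ∪? Q?) ≡ count P? + count Q?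
  count-∪ {zero}  _  _  _        = refl
  count-∪ {suc n} P? Q? disjoint with P? zero | Q? zero | count-∪ (P? ∘ suc) (Q? ∘ suc) disjoint
  ... | yes p | yes q | _  = ⊥-elim (disjoint p q)
  ... | yes _ | no _  | ih = cong suc ih
  ... | no _  | yes _ | ih = trans (cong suc ih) (sym (ℕ.+-suc _ _))
  ... | no _  | no _  | ih = ih

  count-split : {P : Pred (Fin n) ℓ} {Q : Pred (Fin n) ℓ′} (P? : Decidable P) (Q? : Decidable Q) →
                count P? ≡ count (P? ∩? Q?) + count (P? ∩? ∁? Q?)
  count-split {P = P} {Q} P? Q? = trans (count-cong P? ((P? ∩? Q?) ∪? (P? ∩? ∁? Q?)) split [ proj₁ , proj₁ ])
                            (count-∪ (P? ∩? Q?) (P? ∩? ∁? Q?) (λ (_ , q) (_ , ¬q) → ¬q q))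
    where
    split : ∀ {i} → P i → (P i × Q i) ⊎ (P i × ¬ Q i)
    split {i} p with Q? i
    ... | yes q = inj₁ (p , q)
    ... | no ¬q = inj₂ (p , ¬q)

  count-∅ : {P : Pred (Fin n) ℓ} (P? : Decidable P) → (∀ {i} → ¬ P i) → count P? ≡ 0
  count-∅ {zero}  P? ∄ = refl
  count-∅ {suc n} P? ∄ with P? zero
  ... | yes p = ⊥-elim (∄ p)
  ... | no _  = count-∅ (P? ∘ suc) ∄

  count-unique : {P : Pred (Fin n) ℓ} (P? : Decidable P) {x : Fin n} → P x → (∀ {y} → P y → y ≡ x) → count P? ≡ 1
  count-unique {suc n} P? {x} px unique with P? zero
  count-unique {suc n} P? {zero}  px unique | yes _  =
    cong suc (count-∅ (P? ∘ suc) (λ py → case unique py of λ ()))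
  count-unique {suc n} P? {suc x} px unique | yes p₀ = case unique p₀ of λ ()
  count-unique {suc n} P? {zero}  px unique | no ¬p₀ = ⊥-elim (¬p₀ px)
  count-unique {suc n} P? {suc x} px unique | no _   = count-unique (P? ∘ suc) px (suc-injective ∘ unique)

  length-filter-tabulate : {P : Pred A ℓ} (P? : Decidable P) (g : Fin n → A) →
                           length (filter P? (tabulate g)) ≡ count (P? ∘ g)
  length-filter-tabulate {n = zero}  P? g = refl
  length-filter-tabulate {n = suc n} P? g with does (P? (g zero))
  ... | true  = cong suc (length-filter-tabulate P? (g ∘ suc))
  ... | false = length-filter-tabulate P? (g ∘ suc)

  IsOrbitMin : Perm n → Pred (Fin n) 0ℓ
  IsOrbitMin π x = ∀ {y} → SameOrbit π x y → x ≤ᶠ y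

  reflects-to : {P : Set ℓ} {b : Bool} → Reflects P b → T b → P
  reflects-to (ofʸ p) _ = p

  reflects-from : {P : Set ℓ} {b : Bool} → Reflects P b → P → T b
  reflects-from (ofʸ _)  _ = _
  reflects-from (ofⁿ ¬p) p = ¬p p

  isOrbitMin-sound : (π : Perm n) {x : Fin n} → T (isOrbitMin π x) → IsOrbitMin π x
  isOrbitMin-sound {n} π {x} h x~y with sameOrbit-bounded π x~y
  ... | i , refl = reflects-to (proof (x ≤? iter π (toℕ i) x)) (tabulate⁻ (all⁺ _ (allFin n) h) i)

  isOrbitMin-complete : (π : Perm n) {x : Fin n} → IsOrbitMin π x → T (isOrbitMin π x)
  isOrbitMin-complete {n} π {x} least =
    all⁻ (λ i → does (x ≤? iter π (toℕ i) x)) {allFin n}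
    (tabulate⁺ (λ i → reflects-from (proof (x ≤? iter π (toℕ i) x)) (least (toℕ i , refl))))

  isOrbitMin? : (π : Perm n) → Decidable (IsOrbitMin π)
  isOrbitMin? π x = map′ (isOrbitMin-sound π) (isOrbitMin-complete π) (T? (isOrbitMin π x))

  z≡count : (π : Perm n) → z π ≡ count (isOrbitMin? π)
  z≡count π = trans (length-filter-tabulate (T? ∘ isOrbitMin π) (λ x → x))
                    (count-cong _ (isOrbitMin? π) (isOrbitMin-sound π) (isOrbitMin-complete π))

  count-orbitMin : (π : Perm n) (x : Fin n) → count (isOrbitMin? π ∩? sameOrbit? π x) ≡ 1
  count-orbitMin π x with least-element (sameOrbit? π x) (sameOrbit-refl π)
  ... | m , x~m , least = count-unique (isOrbitMin? π ∩? sameOrbit? π x) (m-min , x~m) unique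
    where
    m-min : IsOrbitMin π m
    m-min m~y = least (sameOrbit-trans π x~m m~y)
    unique : ∀ {y} → IsOrbitMin π y × SameOrbit π x y → y ≡ m
    unique (y-min , x~y) = ≤-antisym (y-min (sameOrbit-trans π (sameOrbit-sym π x~y) x~m)) (least x~y)

  ArcAvoids : Perm n → Fin n → Fin n → Fin n → Fin n → Set
  ArcAvoids π x y p q = ¬ InArc π x y p × ¬ InArc π x y q

  inArc-between : (π : Perm n) {x c : Fin n} {i j : ℕ} → i ≤ j →
                  InArc π (iter π i x) (iter π j x) c → ∃[ l ] i < l × l ≤ j × iter π l x ≡ c
  inArc-between π {x} {c} {i} {j} i≤j (m , 1≤m , reach , unreached) with m ℕ.≤? j ∸ i
  ... | yes m≤j∸i = m + i , ℕ.+-monoˡ-≤ i 1≤m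
                  , ℕ.≤-trans (ℕ.+-monoˡ-≤ i m≤j∸i) (ℕ.≤-reflexive (ℕ.m∸n+n≡m i≤j))
                  , trans (iter-+ π m i x) reach
  ... | no m≰j∸i = ⊥-elim (unreached (j ∸ i) (ℕ.≰⇒> m≰j∸i)
                     (trans (sym (iter-+ π (j ∸ i) i x)) (cong (λ k → iter π k x) (ℕ.m∸n+n≡m i≤j))))

  module LeftTransposition (π π′ : Perm n) (p q : Fin n)
           (π′≡ : ∀ u → π′ ⟨$⟩ʳ u ≡ transpose p q (π ⟨$⟩ʳ u)) where

    step-unchanged : ∀ {u} → π ⟨$⟩ʳ u ≢ p → π ⟨$⟩ʳ u ≢ q → π′ ⟨$⟩ʳ u ≡ π ⟨$⟩ʳ u
    step-unchanged ≢p ≢q = trans (π′≡ _) (transpose-≢ ≢p ≢q)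

    step-onto-p : ∀ {u} → π ⟨$⟩ʳ u ≡ p → π′ ⟨$⟩ʳ u ≡ q
    step-onto-p {u} e = trans (π′≡ u) (trans (cong (transpose p q) e) (transpose-≡₁ p q))

    step-onto-q : ∀ {u} → π ⟨$⟩ʳ u ≡ q → π′ ⟨$⟩ʳ u ≡ p
    step-onto-q {u} e = trans (π′≡ u) (trans (cong (transpose p q) e) (transpose-≡₂ p q))

    iter-unchanged : ∀ {x} m → (∀ {l} → l < m → π′ ⟨$⟩ʳ iter π l x ≡ π ⟨$⟩ʳ iter π l x) →
                     iter π′ m x ≡ iter π m x
    iter-unchanged zero    agree = refl
    iter-unchanged (suc m) agree =
      trans (cong (π′ ⟨$⟩ʳ_) (iter-unchanged m (agree ∘ ℕ.m<n⇒m<1+n))) (agree (ℕ.n<1+n m))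

    -- Every step of the shortest π-path from a to b lands in the arc, so π′ takes the same steps.
    sameOrbit-if-arc-avoids : ∀ {a b} → SameOrbit π a b → ArcAvoids π a b p q → SameOrbit π′ a b
    sameOrbit-if-arc-avoids {a} {b} (k , e) (∉p , ∉q) with least-witness (λ k → iter π k a ≟ b) {k} e
    ... | m , reach , before =
      m , trans (iter-unchanged m (λ l<m → step-unchanged (∉p ∘ arc l<m) (∉q ∘ arc l<m))) reach
      where
      arc : ∀ {l c} → l < m → π ⟨$⟩ʳ iter π l a ≡ c → InArc π a b c
      arc l<m e = _ , s≤s z≤n , e , λ j j<1+l → before (ℕ.≤-<-trans (ℕ.≤-pred j<1+l) l<m)

    -- π′ follows the π-path from q back to q, except that its last step, onto q, goes to p.
    join : ¬ SameOrbit π p q → SameOrbit π′ p q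
    join p≁q with iter-period π q
    ... | P , _ , back with least-witness (λ k → iter π (suc k) q ≟ q) {P} back
    ... | m , back-m , before =
      sameOrbit-sym π′ (suc m , trans (cong (π′ ⟨$⟩ʳ_) (iter-unchanged m agree)) (step-onto-q back-m))
      where
      agree : ∀ {l} → l < m → π′ ⟨$⟩ʳ iter π l q ≡ π ⟨$⟩ʳ iter π l q
      agree {l} l<m = step-unchanged (λ e → p≁q (sameOrbit-sym π (suc l , e))) (before l<m)

    module _ (p~q : SameOrbit π p q) where

      sameOrbit-refines : ∀ {x y} → SameOrbit π′ x y → SameOrbit π x y
      sameOrbit-refines {x} (k , refl) = go k
        where
        step′ : ∀ y → SameOrbit π y (π′ ⟨$⟩ʳ y)
        step′ y with π ⟨$⟩ʳ y ≟ p | π ⟨$⟩ʳ y ≟ q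
        ... | yes e | _     = subst (SameOrbit π y) (sym (step-onto-p e))
                                (sameOrbit-trans π (1 , e) p~q)
        ... | no _  | yes e = subst (SameOrbit π y) (sym (step-onto-q e))
                                (sameOrbit-trans π (1 , e) (sameOrbit-sym π p~q))
        ... | no ≢p | no ≢q = subst (SameOrbit π y) (sym (step-unchanged ≢p ≢q)) (sameOrbit-step π)

        go : ∀ k → SameOrbit π x (iter π′ k x)
        go zero    = sameOrbit-refl π
        go (suc k) = sameOrbit-trans π (go k) (step′ _)

      iter-unchanged-off-orbit : ∀ {w} → ¬ SameOrbit π p w → ∀ k → iter π′ k w ≡ iter π k w
      iter-unchanged-off-orbit {w} p≁w k = iter-unchanged k λ {l} _ → step-unchanged
        (λ e → p≁w (sameOrbit-sym π (suc l , e)))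
        (λ e → p≁w (sameOrbit-trans π p~q (sameOrbit-sym π (suc l , e))))

      isOrbitMin-off-orbit : ∀ {w} → ¬ SameOrbit π p w → IsOrbitMin π′ w → IsOrbitMin π w
      isOrbitMin-off-orbit p≁w min′ (k , e) = min′ (k , trans (iter-unchanged-off-orbit p≁w k) e)

      isOrbitMin-off-orbit′ : ∀ {w} → ¬ SameOrbit π p w → IsOrbitMin π w → IsOrbitMin π′ w
      isOrbitMin-off-orbit′ p≁w min (k , e) = min (k , trans (sym (iter-unchanged-off-orbit p≁w k)) e)

    sameOrbit-covers : ∀ {w} → SameOrbit π p w → SameOrbit π′ p w ⊎ SameOrbit π′ q w
    sameOrbit-covers (k , refl) = go k
      where
      go : ∀ k → SameOrbit π′ p (iter π k p) ⊎ SameOrbit π′ q (iter π k p)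
      go zero = inj₁ (sameOrbit-refl π′)
      go (suc k) with π ⟨$⟩ʳ iter π k p ≟ p | π ⟨$⟩ʳ iter π k p ≟ q
      ... | yes e | _     = inj₁ (0 , sym e)
      ... | no _  | yes e = inj₂ (0 , sym e)
      ... | no ≢p | no ≢q = map extend extend (go k)
        where
        extend : ∀ {x} → SameOrbit π′ x (iter π k p) → SameOrbit π′ x (iter π (suc k) p)
        extend {x} x~ = subst (SameOrbit π′ x) (step-unchanged ≢p ≢q) (sameOrbit-trans π′ x~ (sameOrbit-step π′))

    module Cut (p≢q : p ≢ q) (p~q : SameOrbit π p q) where

      private
        first-hit : ∃[ m ] iter π m p ≡ q × (∀ {l} → l < m → iter π l p ≢ q)
        first-hit = least-witness (λ k → iter π k p ≟ q) {proj₁ p~q} (proj₂ p~q)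

      d : ℕ
      d = proj₁ first-hit

      reaches-q : iter π d p ≡ q
      reaches-q = proj₁ (proj₂ first-hit)

      before-q : ∀ {l} → l < d → iter π l p ≢ q
      before-q = proj₂ (proj₂ first-hit)

      0<d : 0 < d
      0<d with d | reaches-q
      ... | zero  | p≡q = ⊥-elim (p≢q p≡q)
      ... | suc _ | _   = s≤s z≤n

      no-return : ∀ {l} → 0 < l → l < d → iter π l p ≢ p
      no-return {l} 0<l l<d e = before-q (ℕ.∸-monoʳ-< 0<l (ℕ.<⇒≤ l<d)) (begin
        iter π (d ∸ l) p              ≡⟨ cong (iter π (d ∸ l)) (sym e) ⟩
        iter π (d ∸ l) (iter π l p)   ≡⟨ sym (iter-+ π (d ∸ l) l p) ⟩
        iter π (d ∸ l + l) p          ≡⟨ cong (λ k → iter π k p) (ℕ.m∸n+n≡m (ℕ.<⇒≤ l<d)) ⟩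
        iter π d p                    ≡⟨ reaches-q ⟩
        q                             ∎)
        where open ≡-Reasoning

      -- π′ closes the π-path p, π p, …, π^(d-1) p into a cycle.
      cut-orbit : ∀ m → ∃[ l ] l < d × iter π′ m p ≡ iter π l p
      cut-orbit zero = 0 , 0<d , refl
      cut-orbit (suc m) with cut-orbit m
      ... | l , l<d , e with ℕ.m≤n⇒m<n∨m≡n l<d
      ...   | inj₁ 1+l<d = suc l , 1+l<d ,
              trans (cong (π′ ⟨$⟩ʳ_) e) (step-unchanged (no-return (s≤s z≤n) 1+l<d) (before-q 1+l<d))
      ...   | inj₂ 1+l≡d = 0 , 0<d , trans (cong (π′ ⟨$⟩ʳ_) e)
              (step-onto-q (trans (cong (λ k → iter π k p) 1+l≡d) reaches-q))

      separated : ¬ SameOrbit π′ p q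
      separated (m , e) with cut-orbit m
      ... | l , l<d , e′ = before-q l<d (trans (sym e′) e)

      avoids-between : ∀ {i j} → i ≤ j → j < d → ArcAvoids π (iter π i p) (iter π j p) p q
      avoids-between {i} {j} i≤j j<d = avoid no-return , avoid (λ _ → before-q)
        where
        avoid : ∀ {c} → (∀ {l} → 0 < l → l < d → iter π l p ≢ c) → ¬ InArc π (iter π i p) (iter π j p) c
        avoid never arc with inArc-between π i≤j arc
        ... | l , i<l , l≤j , e = never (ℕ.≤-<-trans z≤n i<l) (ℕ.≤-<-trans l≤j j<d) e

      arcs-avoid : ∀ {a b} → SameOrbit π′ p a → SameOrbit π′ p b → ArcAvoids π a b p q ⊎ ArcAvoids π b a p q
      arcs-avoid (k , refl) (k′ , refl) with cut-orbit k | cut-orbit k′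
      ... | i , i<d , eᵢ | j , j<d , eⱼ rewrite eᵢ | eⱼ with ℕ.≤-total i j
      ...   | inj₁ i≤j = inj₁ (avoids-between i≤j j<d)
      ...   | inj₂ j≤i = inj₂ (avoids-between j≤i i<d)

      -- The π-orbit of p splits into the π′-orbits of p and q; every other orbit is untouched.
      z-cut : z π′ ≡ suc (z π)
      z-cut = begin
        z π′                                      ≡⟨ z≡count π′ ⟩
        count min′                                ≡⟨ count-split min′ orbit ⟩
        count (min′ ∩? orbit) + count (min′ ∩? ∁? orbit)
                                                  ≡⟨ cong₂ _+_ two-mins-on-orbit mins-off-orbit ⟩
        2 + off-orbit                             ≡⟨ cong (λ c → suc (c + off-orbit)) (sym (count-orbitMin π p)) ⟩
        suc (count (min ∩? orbit) + off-orbit)    ≡⟨ cong suc (sym (count-split min orbit)) ⟩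
        suc (count min)                           ≡⟨ cong suc (sym (z≡count π)) ⟩
        suc (z π)                                 ∎
        where
        open ≡-Reasoning
        min : Decidable (IsOrbitMin π)
        min = isOrbitMin? π
        min′ : Decidable (IsOrbitMin π′)
        min′ = isOrbitMin? π′
        orbit : Decidable (SameOrbit π p)
        orbit = sameOrbit? π p
        off-orbit : ℕ
        off-orbit = count (min ∩? ∁? orbit)
        two-mins-on-orbit : count (min′ ∩? orbit) ≡ 2
        two-mins-on-orbit = begin
          count (min′ ∩? orbit)     ≡⟨ count-cong (min′ ∩? orbit) (on-p ∪? on-q) split join′ ⟩
          count (on-p ∪? on-q)      ≡⟨ count-∪ on-p on-q disjoint ⟩
          count on-p + count on-q   ≡⟨ cong₂ _+_ (count-orbitMin π′ p) (count-orbitMin π′ q) ⟩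
          2                         ∎
          where
          on-p : Decidable (IsOrbitMin π′ ∩ SameOrbit π′ p)
          on-p = min′ ∩? sameOrbit? π′ p
          on-q : Decidable (IsOrbitMin π′ ∩ SameOrbit π′ q)
          on-q = min′ ∩? sameOrbit? π′ q
          split : ∀ {w} → IsOrbitMin π′ w × SameOrbit π p w →
                  (IsOrbitMin π′ w × SameOrbit π′ p w) ⊎ (IsOrbitMin π′ w × SameOrbit π′ q w)
          split (m , p~w) = map (m ,_) (m ,_) (sameOrbit-covers p~w)
          join′ : ∀ {w} → (IsOrbitMin π′ w × SameOrbit π′ p w) ⊎ (IsOrbitMin π′ w × SameOrbit π′ q w) →
                  IsOrbitMin π′ w × SameOrbit π p w
          join′ (inj₁ (m , p~′w)) = m , sameOrbit-refines p~q p~′w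
          join′ (inj₂ (m , q~′w)) = m , sameOrbit-trans π p~q (sameOrbit-refines p~q q~′w)
          disjoint : ∀ {w} → IsOrbitMin π′ w × SameOrbit π′ p w → ¬ (IsOrbitMin π′ w × SameOrbit π′ q w)
          disjoint (_ , p~′w) (_ , q~′w) = separated (sameOrbit-trans π′ p~′w (sameOrbit-sym π′ q~′w))
        mins-off-orbit : count (min′ ∩? ∁? orbit) ≡ off-orbit
        mins-off-orbit = count-cong (min′ ∩? ∁? orbit) (min ∩? ∁? orbit)
          (λ (m , p≁w) → isOrbitMin-off-orbit p~q p≁w m , p≁w)
          (λ (m , p≁w) → isOrbitMin-off-orbit′ p~q p≁w m , p≁w)

  module _ (π π′ : Perm n) {p q : Fin n} (π′≡ : ∀ u → π′ ⟨$⟩ʳ u ≡ transpose p q (π ⟨$⟩ʳ u)) (p≢q : p ≢ q) where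

    private
      π≡ : ∀ u → π ⟨$⟩ʳ u ≡ transpose p q (π′ ⟨$⟩ʳ u)
      π≡ u = trans (sym (transpose-involutive p q (π ⟨$⟩ʳ u))) (cong (transpose p q) (sym (π′≡ u)))

      π′≡ᵠ : ∀ u → π′ ⟨$⟩ʳ u ≡ transpose q p (π ⟨$⟩ʳ u)
      π′≡ᵠ u = trans (π′≡ u) (transpose-sym p q (π ⟨$⟩ʳ u))

    z-cut : SameOrbit π p q → z π′ ≡ suc (z π)
    z-cut = LeftTransposition.Cut.z-cut π π′ p q π′≡ p≢q

    z-join : ¬ SameOrbit π p q → suc (z π′) ≡ z π
    z-join p≁q = sym (LeftTransposition.Cut.z-cut π′ π p q π≡ p≢q (LeftTransposition.join π π′ p q π′≡ p≁q))

    z-≤ : z π′ ≤ suc (z π)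
    z-≤ with sameOrbit? π p q
    ... | yes p~q = ℕ.≤-reflexive (z-cut p~q)
    ... | no p≁q  = ℕ.≤-trans (ℕ.n≤1+n (z π′)) (ℕ.≤-trans (ℕ.≤-reflexive (z-join p≁q)) (ℕ.n≤1+n (z π)))

    cut-separates : SameOrbit π p q → ¬ SameOrbit π′ p q
    cut-separates = LeftTransposition.Cut.separated π π′ p q π′≡ p≢q

    join-connects : ¬ SameOrbit π p q → SameOrbit π′ p q
    join-connects = LeftTransposition.join π π′ p q π′≡

    sameOrbit-after-transposition : SameOrbit π p q → ∀ {a b} →
      SameOrbit π′ a b ⇔ (SameOrbit π a b × (ArcAvoids π a b p q ⊎ ArcAvoids π b a p q))
    sameOrbit-after-transposition p~q {a} {b} = mk⇔ to from
      where
      open LeftTransposition π π′ p q π′≡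
      module Cutᵖ = Cut p≢q p~q
      module Cutᵠ = LeftTransposition.Cut π π′ q p π′≡ᵠ (p≢q ∘ sym) (sameOrbit-sym π p~q)
      to : SameOrbit π′ a b → SameOrbit π a b × (ArcAvoids π a b p q ⊎ ArcAvoids π b a p q)
      to a~′b = sameOrbit-refines p~q a~′b , arcs (sameOrbit? π p a)
        where
        arcs : Dec (SameOrbit π p a) → ArcAvoids π a b p q ⊎ ArcAvoids π b a p q
        arcs (no p≁a) = inj₁ ((λ (i , _ , e , _) → p≁a (sameOrbit-sym π (i , e)))
                           , (λ (i , _ , e , _) → p≁a (sameOrbit-trans π p~q (sameOrbit-sym π (i , e)))))
        arcs (yes p~a) with sameOrbit-covers p~a
        ... | inj₁ p~′a = Cutᵖ.arcs-avoid p~′a (sameOrbit-trans π′ p~′a a~′b)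
        ... | inj₂ q~′a = map swap swap (Cutᵠ.arcs-avoid q~′a (sameOrbit-trans π′ q~′a a~′b))
      from : SameOrbit π a b × (ArcAvoids π a b p q ⊎ ArcAvoids π b a p q) → SameOrbit π′ a b
      from (a~b , inj₁ avoids) = sameOrbit-if-arc-avoids a~b avoids
      from (a~b , inj₂ avoids) = sameOrbit-sym π′ (sameOrbit-if-arc-avoids (sameOrbit-sym π a~b) avoids)

    sameOrbit-after-cut⇔ : ∀ {a b} → (SameOrbit π p q × SameOrbit π′ a b) ⇔
      (SameOrbit π a b × SameOrbit π p q × (ArcAvoids π a b p q ⊎ ArcAvoids π b a p q))
    sameOrbit-after-cut⇔ = mk⇔
      (λ (p~q , a~′b) → let a~b , arcs = Equivalence.to (sameOrbit-after-transposition p~q) a~′b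
                         in a~b , p~q , arcs)
      (λ (a~b , p~q , arcs) → p~q , Equivalence.from (sameOrbit-after-transposition p~q) (a~b , arcs))

  -- With π = t σ, conj σ t = (π a  π b) π: of these two left multiplications by a transposition one cuts
  -- and the other joins.
  z-conj-transpose : (σ : Perm n) {a b : Fin n} → a ≢ b → z (conj σ (Perm.transpose a b)) ≡ z σ
  z-conj-transpose {n} σ {a} {b} a≢b = by-cases (sameOrbit? σ a b)
    where
    t π : Perm n
    t = Perm.transpose a b
    π = t · σ
    πa≢πb : π ⟨$⟩ʳ a ≢ π ⟨$⟩ʳ b
    πa≢πb = a≢b ∘ ⟨$⟩ʳ-injective π
    tσt≡ : ∀ u → conj σ t ⟨$⟩ʳ u ≡ transpose (π ⟨$⟩ʳ a) (π ⟨$⟩ʳ b) (π ⟨$⟩ʳ u)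
    tσt≡ u = trans (cong (π ⟨$⟩ʳ_) (transpose-sym b a u)) (⟨$⟩ʳ-transpose π a b u)
    by-cases : Dec (SameOrbit σ a b) → z (conj σ t) ≡ z σ
    by-cases (yes a~b) = ℕ.suc-injective (trans
      (z-join π (conj σ t) tσt≡ πa≢πb (cut-separates σ π (λ _ → refl) a≢b a~b ∘ sameOrbit-⟨$⟩ʳ⁻ π))
      (z-cut σ π (λ _ → refl) a≢b a~b))
    by-cases (no a≁b) = trans
      (z-cut π (conj σ t) tσt≡ πa≢πb (sameOrbit-⟨$⟩ʳ π (join-connects σ π (λ _ → refl) a≢b a≁b)))
      (z-join σ π (λ _ → refl) a≢b a≁b)

  module _ (π π₁ π₂ : Perm n) {p q r s : Fin n}
           (π₁≡ : ∀ u → π₁ ⟨$⟩ʳ u ≡ transpose p q (π ⟨$⟩ʳ u))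
           (π₂≡ : ∀ u → π₂ ⟨$⟩ʳ u ≡ transpose r s (π₁ ⟨$⟩ʳ u))
           (p≢q : p ≢ q) (r≢s : r ≢ s) where

    z-cut-cut : SameOrbit π p q → SameOrbit π₁ r s → z π₂ ≡ 2 + z π
    z-cut-cut p~q r~s = trans (z-cut π₁ π₂ π₂≡ r≢s r~s) (cong suc (z-cut π π₁ π₁≡ p≢q p~q))

    z-≤-unless-cut-cut : ¬ (SameOrbit π p q × SameOrbit π₁ r s) → z π₂ ≤ z π
    z-≤-unless-cut-cut ¬cut-cut with sameOrbit? π p q
    ... | yes p~q = ℕ.≤-reflexive (ℕ.suc-injective
            (trans (z-join π₁ π₂ π₂≡ r≢s (¬cut-cut ∘ (p~q ,_))) (z-cut π π₁ π₁≡ p≢q p~q)))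
    ... | no p≁q  = ℕ.≤-trans (z-≤ π₁ π₂ π₂≡ r≢s) (ℕ.≤-reflexive (z-join π π₁ π₁≡ p≢q p≁q))

open Orbits

open import Defs
open import Data.Empty using (⊥-elim)
open import Data.Fin using (Fin)
open import Data.Fin.Permutation using (_⟨$⟩ʳ_; transpose)
import Data.Fin.Permutation.Components as PC
open import Data.Integer as ℤ using (ℤ; +_)
import Data.Integer.Properties as ℤ
open import Data.Integer.Solver using (module +-*-Solver)
open import Data.Nat as ℕ using (ℕ)
import Data.Nat.Properties as ℕ
open import Data.Product using (_×_; _,_; uncurry)
open import Data.Rational using (ℚ; _<_; _≤_; _+_; _-_; -_; _/_; 0ℚ; 1ℚ; toℚᵘ)
open import Data.Rational.Properties
  using ( toℚᵘ-injective; toℚᵘ-fromℚᵘ; toℚᵘ-homo-+; normalize-nonNeg; nonNegative⁻¹; negative⁻¹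
        ; ≤-reflexive; ≤-trans; <-≤-trans; <-irrefl; +-assoc; +-identityʳ; neg-distrib-+
        ; +-monoʳ-≤; +-monoʳ-<; neg-antimono-≤; module ≤-Reasoning )
import Data.Rational.Unnormalised as ℚᵘ
import Data.Rational.Unnormalised.Properties as ℚᵘ
open import Data.Sum using (_⊎_)
open import Function using (_∘_; const)
open import Function.Bundles using (_⇔_; mk⇔)
open import Function.Properties.Equivalence using () renaming (trans to ⇔-trans)
open import Relation.Binary.PropositionalEquality
  using (_≡_; _≢_; refl; sym; trans; cong; subst; module ≡-Reasoning)
open import Relation.Nullary using (¬_; Dec; yes; no)
open import Relation.Nullary.Decidable using (_×-dec_)

private variable n : ℕ

half-+ : (i j : ℤ) → (i ℤ.+ j) / 2 ≡ i / 2 + j / 2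
half-+ i j = toℚᵘ-injective (begin-equality
  toℚᵘ ((i ℤ.+ j) / 2)                ≃⟨ toℚᵘ-fromℚᵘ (ℚᵘ.mkℚᵘ (i ℤ.+ j) 1) ⟩
  ℚᵘ.mkℚᵘ (i ℤ.+ j) 1                 ≃⟨ ℚᵘ.*≡* cross-multiplied ⟩
  ℚᵘ.mkℚᵘ i 1 ℚᵘ.+ ℚᵘ.mkℚᵘ j 1        ≃⟨ ℚᵘ.+-cong (toℚᵘ-fromℚᵘ (ℚᵘ.mkℚᵘ i 1)) (toℚᵘ-fromℚᵘ (ℚᵘ.mkℚᵘ j 1)) ⟨
  toℚᵘ (i / 2) ℚᵘ.+ toℚᵘ (j / 2)      ≃⟨ toℚᵘ-homo-+ (i / 2) (j / 2) ⟨
  toℚᵘ (i / 2 + j / 2)                ∎)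
  where
  open ℚᵘ.≤-Reasoning
  cross-multiplied : (i ℤ.+ j) ℤ.* + 4 ≡ (i ℤ.* + 2 ℤ.+ j ℤ.* + 2) ℤ.* + 2
  cross-multiplied = solve 2 (λ i j → (i :+ j) :* con (+ 4) := (i :* con (+ 2) :+ j :* con (+ 2)) :* con (+ 2)) refl i j
    where open +-*-Solver

p-q≤p : (p q : ℚ) → 0ℚ ≤ q → p - q ≤ p
p-q≤p p q 0≤q = ≤-trans (+-monoʳ-≤ p (neg-antimono-≤ 0≤q)) (≤-reflexive (+-identityʳ p))

p-1<p : (p : ℚ) → p - 1ℚ < p
p-1<p p = <-≤-trans (+-monoʳ-< p (negative⁻¹ (- 1ℚ))) (≤-reflexive (+-identityʳ p))

chi-shift : (σ₀ σ₀′ σ₁ : Perm n) (k : ℕ) → z σ₀′ ≡ z σ₀ → z (σ₀′ · σ₁) ≡ k ℕ.+ z (σ₀ · σ₁) →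
            chi σ₀′ σ₁ ≡ chi σ₀ σ₁ ℤ.+ + k
chi-shift {n} σ₀ σ₀′ σ₁ k z₀′≡ zρ′≡ rewrite z₀′≡ | zρ′≡ = begin
  K ℤ.+ + (k ℕ.+ z ρ)      ≡⟨ cong (λ c → K ℤ.+ c) (trans (ℤ.pos-+ k (z ρ)) (ℤ.+-comm (+ k) (+ z ρ))) ⟩
  K ℤ.+ (+ z ρ ℤ.+ + k)    ≡⟨ ℤ.+-assoc K (+ z ρ) (+ k) ⟨
  K ℤ.+ + z ρ ℤ.+ + k      ∎
  where
  open ≡-Reasoning
  ρ : Perm n
  ρ = σ₀ · σ₁
  K : ℤ
  K = + z σ₀ ℤ.+ + z σ₁ ℤ.- + n

genus-shift : (σ₀ σ₀′ σ₁ : Perm n) (k : ℕ) → chi σ₀′ σ₁ ≡ chi σ₀ σ₁ ℤ.+ + k →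
              genus σ₀′ σ₁ ≡ genus σ₀ σ₁ - (+ k) / 2
genus-shift σ₀ σ₀′ σ₁ k χ′≡ = begin
  1ℚ - chi σ₀′ σ₁ / 2               ≡⟨ cong (λ c → 1ℚ - c / 2) χ′≡ ⟩
  1ℚ - (χ ℤ.+ + k) / 2              ≡⟨ cong (λ x → 1ℚ - x) (half-+ χ (+ k)) ⟩
  1ℚ - (χ / 2 + (+ k) / 2)          ≡⟨ cong (λ x → 1ℚ + x) (neg-distrib-+ (χ / 2) ((+ k) / 2)) ⟩
  1ℚ + (- (χ / 2) + - ((+ k) / 2))  ≡⟨ +-assoc 1ℚ (- (χ / 2)) (- ((+ k) / 2)) ⟨
  1ℚ - χ / 2 - (+ k) / 2            ∎
  where
  open ≡-Reasoning
  χ : ℤ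
  χ = chi σ₀ σ₁

genus-drop : (σ₀ σ₀′ σ₁ : Perm n) → z σ₀′ ≡ z σ₀ → z (σ₀′ · σ₁) ≡ 2 ℕ.+ z (σ₀ · σ₁) →
             genus σ₀′ σ₁ ≡ genus σ₀ σ₁ - 1ℚ
genus-drop σ₀ σ₀′ σ₁ z₀′≡ zρ′≡ = genus-shift σ₀ σ₀′ σ₁ 2 (chi-shift σ₀ σ₀′ σ₁ 2 z₀′≡ zρ′≡)

genus-no-drop : (σ₀ σ₀′ σ₁ : Perm n) → z σ₀′ ≡ z σ₀ → z (σ₀′ · σ₁) ℕ.≤ z (σ₀ · σ₁) →
                genus σ₀ σ₁ ≤ genus σ₀′ σ₁
genus-no-drop σ₀ σ₀′ σ₁ z₀′≡ zρ′≤ = begin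
  genus σ₀ σ₁                  ≡⟨ genus-shift σ₀′ σ₀ σ₁ k (chi-shift σ₀′ σ₀ σ₁ k (sym z₀′≡) (sym (ℕ.m∸n+n≡m zρ′≤))) ⟩
  genus σ₀′ σ₁ - (+ k) / 2     ≤⟨ p-q≤p (genus σ₀′ σ₁) ((+ k) / 2) (nonNegative⁻¹ ((+ k) / 2) {{normalize-nonNeg k 2}}) ⟩
  genus σ₀′ σ₁                 ∎
  where
  open ≤-Reasoning
  k : ℕ
  k = z (σ₀ · σ₁) ℕ.∸ z (σ₀′ · σ₁)

genus-decreases⇔ : (σ₀ σ₀′ σ₁ : Perm n) {C : Set} → Dec C → z σ₀′ ≡ z σ₀ →
                   (C → z (σ₀′ · σ₁) ≡ 2 ℕ.+ z (σ₀ · σ₁)) → (¬ C → z (σ₀′ · σ₁) ℕ.≤ z (σ₀ · σ₁)) →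
                   (genus σ₀′ σ₁ < genus σ₀ σ₁ ⇔ C) × (genus σ₀′ σ₁ < genus σ₀ σ₁ → genus σ₀′ σ₁ ≡ genus σ₀ σ₁ - 1ℚ)
genus-decreases⇔ σ₀ σ₀′ σ₁ (yes c) z₀′≡ drop _ = mk⇔ (const c) (const g′<g) , const g′≡g-1
  where
  g′≡g-1 : genus σ₀′ σ₁ ≡ genus σ₀ σ₁ - 1ℚ
  g′≡g-1 = genus-drop σ₀ σ₀′ σ₁ z₀′≡ (drop c)
  g′<g : genus σ₀′ σ₁ < genus σ₀ σ₁
  g′<g = subst (_< genus σ₀ σ₁) (sym g′≡g-1) (p-1<p (genus σ₀ σ₁))
genus-decreases⇔ σ₀ σ₀′ σ₁ (no ¬c) z₀′≡ _ no-drop = mk⇔ (⊥-elim ∘ g′≮g) (⊥-elim ∘ ¬c) , ⊥-elim ∘ g′≮g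
  where
  g′≮g : ¬ genus σ₀′ σ₁ < genus σ₀ σ₁
  g′≮g g′<g = <-irrefl refl (<-≤-trans g′<g (genus-no-drop σ₀ σ₀′ σ₁ z₀′≡ (no-drop ¬c)))

mainTheorem7 : ∀ {n} (σ₀ σ₁ : Perm n) (a b : Fin n) → a ≢ b →
    let t  = transpose a b
        ρ  = σ₀ · σ₁
        a′ = σ₀ ⟨$⟩ʳ a
        b′ = σ₀ ⟨$⟩ʳ b
        g  = genus σ₀ σ₁
        gᵗ = genus (conj σ₀ t) σ₁
    in (gᵗ < g ⇔
         (SameOrbit ρ a b × SameOrbit ρ a′ b′ ×
          ((¬ InArc ρ a b a′ × ¬ InArc ρ a b b′) ⊎ (¬ InArc ρ b a a′ × ¬ InArc ρ b a b′))))
       × (gᵗ < g → gᵗ ≡ g - 1ℚ)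
mainTheorem7 {n} σ₀ σ₁ a b a≢b =
  let drop⇔cut-cut , drop-by-1 = genus-decreases⇔ σ₀ σ₀ᵗ σ₁ (sameOrbit? ρ a′ b′ ×-dec sameOrbit? ρ₁ a b)
                                 (z-conj-transpose σ₀ a≢b)
                                 (uncurry (z-cut-cut ρ ρ₁ (σ₀ᵗ · σ₁) (λ _ → refl) ρᵗ≡ a′≢b′ a≢b))
                                 (z-≤-unless-cut-cut ρ ρ₁ (σ₀ᵗ · σ₁) (λ _ → refl) ρᵗ≡ a′≢b′ a≢b)
  in ⇔-trans drop⇔cut-cut (sameOrbit-after-cut⇔ ρ ρ₁ (λ _ → refl) a′≢b′) , drop-by-1
  where
  a′ b′ : Fin n
  a′ = σ₀ ⟨$⟩ʳ a
  b′ = σ₀ ⟨$⟩ʳ b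
  σ₀ᵗ ρ ρ₁ : Perm n
  σ₀ᵗ = conj σ₀ (transpose a b)
  ρ   = σ₀ · σ₁
  ρ₁  = transpose a′ b′ · ρ
  a′≢b′ : a′ ≢ b′
  a′≢b′ = a≢b ∘ ⟨$⟩ʳ-injective σ₀
  ρᵗ≡ : ∀ u → (σ₀ᵗ · σ₁) ⟨$⟩ʳ u ≡ PC.transpose a b (ρ₁ ⟨$⟩ʳ u)
  ρᵗ≡ u = cong (PC.transpose a b) (trans (⟨$⟩ʳ-transpose σ₀ b a (σ₁ ⟨$⟩ʳ u)) (transpose-sym b′ a′ (ρ ⟨$⟩ʳ u)))
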